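{- Let $n$ and $g$ be integers with $n\geq 4$ and $1\leq g\leq n-3$. Then $t_g(LTQ_n)\leq 2^g(n-g+1)-1$ both under the PMC model and under the MM$^*$ model.
   Context: The locally twisted cube $LTQ_n$ ($n\ge 2$) has vertex set $\{0,1\}^n$, vertices written $u=u_{n-1}\ldots u_1u_0$. Two vertices $u,v$ are adjacent iff either (1) there is $k$ with $2\le k\le n-1$ such that $u_k=\overline{v_k}$, $u_{k-1}=v_{k-1}\oplus u_0$ (addition mod 2), and all remaining bits agree; or (2) $u_k=\overline{v_k}$ for some $k\in\{0,1\}$ and $u_r=v_r$ for all $r=2,\ldots,n-1$. PMC model: for $G=(V,E)$ and faulty set $F$, each vertex $u$ tests each neighbor $v$ with outcome $0$ if $u,v\notin F$, $1$ if $u\notin F$, $v\in F$, arbitrary if $u\in F$. MM$^*$ model: each vertex $w$ compares every pair $\{u,v\}$ of its distinct neighbors, outcome $0$ if $u,v,w\notin F$, $1$ if $w\notin F$ and $\{u,v\}\cap F\ne\emptyset$, arbitrary if $w\in F$. In either model, $\sigma(F)$ is the set of syndromes (collections of all outcomes) producible by $F$, and distinct $F_1,F_2$ are distinguishable iff $\sigma(F_1)\cap\sigma(F_2)=\emptyset$. A set $F\subseteq V$ is a $g$-good-neighbor conditional faulty set if every $v\in V\setminus F$ has at least $g$ neighbors in $V\setminus F$. $t_g(G)$ (in a given model) is the maximum $t$ such that every two distinct $g$-good-neighbor conditional faulty sets of size at most $t$ are distinguishable in that model. -}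

module Defs where

open import Data.Bool using (Bool; true; false; not; _xor_; _∨_)
open import Data.Nat using (ℕ; zero; suc; _+_; _*_; _∸_; _^_; _≤_; _<_)
open import Data.List using (List; []; _∷_; map; _++_; length; filterᵇ)
open import Data.List.Relation.Unary.All using (All)
open import Data.List.Relation.Unary.Unique.Propositional using (Unique)
open import Data.Vec using (Vec; []; _∷_)
open import Data.Product using (Σ; _×_; _,_)
open import Data.Sum using (_⊎_)
open import Data.Empty using (⊥)
open import Relation.Binary.PropositionalEquality using (_≡_; _≢_)

Vertex : ℕ → Set
Vertex n = Vec Bool n

-- bit u i = u_i (bit at position i, 0 ≤ i < n); positions ≥ n give false (never used).
bit : ∀ {n} → Vertex n → ℕ → Bool
bit []       _       = false
bit (b ∷ _)  zero    = b
bit (_ ∷ bs) (suc i) = bit bs i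

LTQAdj : (n : ℕ) → Vertex n → Vertex n → Set
LTQAdj n u v =
    (Σ ℕ λ k → 2 ≤ k × k < n
       × bit u k ≡ not (bit v k)
       × bit u (k ∸ 1) ≡ (bit v (k ∸ 1) xor bit u 0)
       × (∀ r → r < n → r ≢ k → r ≢ k ∸ 1 → bit u r ≡ bit v r))
  ⊎ (Σ ℕ λ k → k < 2
       × bit u k ≡ not (bit v k)
       × (∀ r → r < n → r ≢ k → bit u r ≡ bit v r))

allVertices : (n : ℕ) → List (Vertex n)
allVertices zero    = [] ∷ []
allVertices (suc n) = map (false ∷_) (allVertices n) ++ map (true ∷_) (allVertices n)

-- A vertex set F ⊆ V, given by its characteristic function (v ∈ F iff F v ≡ true).
VSet : ℕ → Set
VSet n = Vertex n → Bool

size : ∀ {n} → VSet n → ℕ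
size {n} F = length (filterᵇ F (allVertices n))

Distinct : ∀ {n} → VSet n → VSet n → Set
Distinct F₁ F₂ = (∀ v → F₁ v ≡ F₂ v) → ⊥

GoodNeighbor : (n g : ℕ) → VSet n → Set
GoodNeighbor n g F =
  ∀ v → F v ≡ false →
    Σ (List (Vertex n)) λ L → Unique L × g ≤ length L
      × All (λ u → LTQAdj n v u × F u ≡ false) L

-- PMC model: a syndrome assigns an outcome to each test (u tests v).
-- Entries for non-adjacent pairs are irrelevant (unconstrained).
PMCSyndrome : ℕ → Set
PMCSyndrome n = Vertex n → Vertex n → Bool

InSigmaPMC : (n : ℕ) → VSet n → PMCSyndrome n → Set
InSigmaPMC n F s = ∀ u v → LTQAdj n u v → F u ≡ false → s u v ≡ F v

-- MM* model: s w u v is the outcome of w comparing neighbours u, v.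
MMSyndrome : ℕ → Set
MMSyndrome n = Vertex n → Vertex n → Vertex n → Bool

InSigmaMM : (n : ℕ) → VSet n → MMSyndrome n → Set
InSigmaMM n F s =
  ∀ w u v → LTQAdj n w u → LTQAdj n w v → u ≢ v → F w ≡ false →
    s w u v ≡ (F u ∨ F v)

Distinguishable : ∀ {n} (Syn : Set) (InSigma : VSet n → Syn → Set) → VSet n → VSet n → Set
Distinguishable Syn InSigma F₁ F₂ = ∀ (s : Syn) → InSigma F₁ s → InSigma F₂ s → ⊥

-- "every two distinct g-good-neighbor conditional faulty sets of size ≤ t
--  are distinguishable" (t_g(LTQ_n) is the maximum t with this property)
GoodNeighborDiagnosable : (n g : ℕ) (Syn : Set) (InSigma : VSet n → Syn → Set) → ℕ → Set
GoodNeighborDiagnosable n g Syn InSigma t =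
  ∀ (F₁ F₂ : VSet n) → GoodNeighbor n g F₁ → GoodNeighbor n g F₂ →
    size F₁ ≤ t → size F₂ ≤ t → Distinct F₁ F₂ →
    Distinguishable Syn InSigma F₁ F₂

-- Write u = u₀ a w with a = u₁…u_g and w = u_{g+1}…u_{n-1}, and let A be the
-- subcube {u : u₀ = 0, w = 0} spanned by dimensions 1, …, g.  Since edges of
-- dimensions 1, …, g keep u₀ and w, every set determined by (u₀, w) is a
-- g-good-neighbor set.  Take F₁ = N(A) and F₂ = N[A] = A ∪ N(A): these are the
-- vertices with exactly one, resp. at most one, of the n - g bits u₀, w true, so
-- |F₂| = 2^g (n - g + 1).  A vertex outside F₂ has no neighbour in A = F₂ ∖ F₁,
-- hence it sees F₁ and F₂ alike, and the syndrome of F₁ in which every test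
-- reports the truth is also a syndrome of F₂, in both models.
module Submission where

open import Data.Bool using (Bool; true; false; not; _∧_; _∨_; _xor_)
open import Data.Bool.Properties using (not-involutive; not-¬; xor-assoc; xor-same; xor-identityʳ)
open import Data.Empty using (⊥-elim)
open import Data.List using (List; []; _∷_; map; _++_; length; filterᵇ; drop)
open import Data.List.Properties using (filter-++; length-++; filter-none)
open import Data.List.Relation.Unary.All using (All; []; _∷_; universal)
open import Data.List.Relation.Unary.AllPairs using ([]; _∷_)
open import Data.List.Relation.Unary.Unique.Propositional using (Unique)
open import Data.Nat using (ℕ; zero; suc; _+_; _*_; _∸_; _^_; _≤_; _<_; z≤n; s≤s; _≤?_; _≟_)
open import Data.Nat.Properties
open import Data.Product using (_×_; _,_)
open import Data.Sum using (inj₁; inj₂)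
open import Data.Vec using (Vec; []; _∷_; toList; replicate)
open import Function using (_∘_)
open import Relation.Nullary using (¬_; yes; no)
open import Relation.Nullary.Decidable using (T?)
open import Relation.Binary.PropositionalEquality

open import Defs

length-filterᵇ-map : ∀ {A B : Set} (p : B → Bool) (f : A → B) (xs : List A) →
  length (filterᵇ p (map f xs)) ≡ length (filterᵇ (p ∘ f) xs)
length-filterᵇ-map p f [] = refl
length-filterᵇ-map p f (x ∷ xs) with p (f x)
... | true  = cong suc (length-filterᵇ-map p f xs)
... | false = length-filterᵇ-map p f xs

size-∷ : ∀ m (F : VSet (suc m)) →
  size F ≡ size (F ∘ (false ∷_)) + size (F ∘ (true ∷_))
size-∷ m F = begin
  length (filterᵇ F (map (false ∷_) vs ++ map (true ∷_) vs))
    ≡⟨ cong length (filter-++ (T? ∘ F) (map (false ∷_) vs) _) ⟩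
  length (filterᵇ F (map (false ∷_) vs) ++ filterᵇ F (map (true ∷_) vs))
    ≡⟨ length-++ (filterᵇ F (map (false ∷_) vs)) ⟩
  length (filterᵇ F (map (false ∷_) vs)) + length (filterᵇ F (map (true ∷_) vs))
    ≡⟨ cong₂ _+_ (length-filterᵇ-map F (false ∷_) vs) (length-filterᵇ-map F (true ∷_) vs) ⟩
  size (F ∘ (false ∷_)) + size (F ∘ (true ∷_)) ∎
  where
  open ≡-Reasoning
  vs = allVertices m

size-∅ : ∀ {m} → size {m} (λ _ → false) ≡ 0
size-∅ {m} = cong length (filter-none (T? ∘ λ _ → false) (universal (λ _ ()) (allVertices m)))

size-drop : ∀ {m} (P : List Bool → Bool) g → g ≤ m →
  size {m} (λ w → P (drop g (toList w))) ≡ 2 ^ g * size {m ∸ g} (P ∘ toList)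
size-drop P zero _ = sym (*-identityˡ _)
size-drop {suc m} P (suc g) (s≤s g≤m) = begin
  size {suc m} (λ w → P (drop (suc g) (toList w)))
                                   ≡⟨ size-∷ m (λ w → P (drop (suc g) (toList w))) ⟩
  S + S                            ≡⟨ cong₂ _+_ ih ih ⟩
  T + T                            ≡⟨ cong (T +_) (+-identityʳ T) ⟨
  2 * T                            ≡⟨ *-assoc 2 (2 ^ g) _ ⟨
  2 ^ suc g * size {m ∸ g} (P ∘ toList) ∎
  where
  open ≡-Reasoning
  S = size {m} (λ w → P (drop g (toList w)))
  T = 2 ^ g * size {m ∸ g} (P ∘ toList)
  ih = size-drop P g g≤m

allFalse : List Bool → Bool
allFalse []          = true
allFalse (false ∷ l) = allFalse l
allFalse (true ∷ l)  = false

atMostOneTrue : List Bool → Bool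
atMostOneTrue []          = true
atMostOneTrue (false ∷ l) = atMostOneTrue l
atMostOneTrue (true ∷ l)  = allFalse l

exactlyOneTrue : List Bool → Bool
exactlyOneTrue l = not (allFalse l) ∧ atMostOneTrue l

allFalse⇒atMostOneTrue : ∀ l → allFalse l ≡ true → atMostOneTrue l ≡ true
allFalse⇒atMostOneTrue []          _ = refl
allFalse⇒atMostOneTrue (false ∷ l) p = allFalse⇒atMostOneTrue l p

atMostOneTrue-∷ : ∀ b l → allFalse l ≡ true → atMostOneTrue (b ∷ l) ≡ true
atMostOneTrue-∷ false l = allFalse⇒atMostOneTrue l
atMostOneTrue-∷ true  l p = p

allFalse⇒exactlyOneTrue≢atMostOneTrue : ∀ l → allFalse l ≡ true → exactlyOneTrue l ≢ atMostOneTrue l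
allFalse⇒exactlyOneTrue≢atMostOneTrue l l≡0 same with () ←
  trans (sym (cong (λ b → not b ∧ atMostOneTrue l) l≡0)) (trans same (allFalse⇒atMostOneTrue l l≡0))

size-allFalse : ∀ k → size {k} (allFalse ∘ toList) ≡ 1
size-allFalse zero    = refl
size-allFalse (suc k) =
  trans (size-∷ k (allFalse ∘ toList)) (cong₂ _+_ (size-allFalse k) (size-∅ {k}))

size-exactlyOneTrue : ∀ k → size {k} (exactlyOneTrue ∘ toList) ≡ k
size-exactlyOneTrue zero    = refl
size-exactlyOneTrue (suc k) =
  trans (size-∷ k (exactlyOneTrue ∘ toList))
        (trans (cong₂ _+_ (size-exactlyOneTrue k) (size-allFalse k)) (+-comm k 1))

size-atMostOneTrue : ∀ k → size {k} (atMostOneTrue ∘ toList) ≡ k + 1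
size-atMostOneTrue zero    = refl
size-atMostOneTrue (suc k) =
  trans (size-∷ k (atMostOneTrue ∘ toList))
        (trans (cong₂ _+_ (size-atMostOneTrue k) (size-allFalse k)) (+-comm (k + 1) 1))

allFalse-drop⇒bit≡false : ∀ {m} g (w : Vec Bool m) → allFalse (drop g (toList w)) ≡ true →
  ∀ r → g ≤ r → bit w r ≡ false
allFalse-drop⇒bit≡false g [] _ r _ = refl
allFalse-drop⇒bit≡false zero (false ∷ w) p zero    _ = refl
allFalse-drop⇒bit≡false zero (false ∷ w) p (suc r) _ = allFalse-drop⇒bit≡false zero w p r z≤n
allFalse-drop⇒bit≡false (suc g) (_ ∷ w) p (suc r) (s≤s g≤r) = allFalse-drop⇒bit≡false g w p r g≤r

bit≡false⇒allFalse-drop : ∀ {m} g (w : Vec Bool m) → (∀ r → g ≤ r → r < m → bit w r ≡ false) →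
  allFalse (drop g (toList w)) ≡ true
bit≡false⇒allFalse-drop zero    [] _ = refl
bit≡false⇒allFalse-drop (suc g) [] _ = refl
bit≡false⇒allFalse-drop zero (c ∷ w) h rewrite h 0 z≤n (s≤s z≤n) =
  bit≡false⇒allFalse-drop zero w (λ r _ r<m → h (suc r) z≤n (s≤s r<m))
bit≡false⇒allFalse-drop (suc g) (_ ∷ w) h =
  bit≡false⇒allFalse-drop g w (λ r g≤r r<m → h (suc r) (s≤s g≤r) (s≤s r<m))

bit≡false⇒atMostOneTrue-drop : ∀ {m} g k (w : Vec Bool m) →
  (∀ r → g ≤ r → r < m → r ≢ k → bit w r ≡ false) → atMostOneTrue (drop g (toList w)) ≡ true
bit≡false⇒atMostOneTrue-drop zero    k [] _ = refl
bit≡false⇒atMostOneTrue-drop (suc g) k [] _ = refl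
bit≡false⇒atMostOneTrue-drop zero zero (c ∷ w) h =
  atMostOneTrue-∷ c _ (bit≡false⇒allFalse-drop zero w (λ r _ r<m → h (suc r) z≤n (s≤s r<m) λ ()))
bit≡false⇒atMostOneTrue-drop zero (suc k) (c ∷ w) h rewrite h 0 z≤n (s≤s z≤n) (λ ()) =
  bit≡false⇒atMostOneTrue-drop zero k w
    (λ r _ r<m r≢k → h (suc r) z≤n (s≤s r<m) (r≢k ∘ suc-injective))
bit≡false⇒atMostOneTrue-drop (suc g) zero (_ ∷ w) h =
  bit≡false⇒atMostOneTrue-drop g zero w (λ r g≤r r<m _ → h (suc r) (s≤s g≤r) (s≤s r<m) λ ())
bit≡false⇒atMostOneTrue-drop (suc g) (suc k) (_ ∷ w) h =
  bit≡false⇒atMostOneTrue-drop g k w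
    (λ r g≤r r<m r≢k → h (suc r) (s≤s g≤r) (s≤s r<m) (r≢k ∘ suc-injective))

mapAt : ∀ {n} → ℕ → (Bool → Bool) → Vertex n → Vertex n
mapAt _       f []      = []
mapAt zero    f (b ∷ u) = f b ∷ u
mapAt (suc k) f (b ∷ u) = b ∷ mapAt k f u

bit-mapAt-≡ : ∀ {n} k f (u : Vertex n) → k < n → bit (mapAt k f u) k ≡ f (bit u k)
bit-mapAt-≡ zero    f (b ∷ u) _         = refl
bit-mapAt-≡ (suc k) f (b ∷ u) (s≤s k<n) = bit-mapAt-≡ k f u k<n

bit-mapAt-≢ : ∀ {n} k f r (u : Vertex n) → r ≢ k → bit (mapAt k f u) r ≡ bit u r
bit-mapAt-≢ k       f r       []      _   = refl
bit-mapAt-≢ zero    f zero    (b ∷ u) r≢k = ⊥-elim (r≢k refl)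
bit-mapAt-≢ zero    f (suc r) (b ∷ u) _   = refl
bit-mapAt-≢ (suc k) f zero    (b ∷ u) _   = refl
bit-mapAt-≢ (suc k) f (suc r) (b ∷ u) r≢k = bit-mapAt-≢ k f r u (r≢k ∘ cong suc)

drop-toList-mapAt : ∀ {n} g k f (u : Vertex n) → k < g →
  drop g (toList (mapAt k f u)) ≡ drop g (toList u)
drop-toList-mapAt (suc g) k       f []      _         = refl
drop-toList-mapAt (suc g) zero    f (b ∷ u) _         = refl
drop-toList-mapAt (suc g) (suc k) f (b ∷ u) (s≤s k<g) = drop-toList-mapAt g k f u k<g

neighbour : ∀ {n} → ℕ → Vertex n → Vertex n
neighbour zero          u = mapAt 0 not u
neighbour (suc zero)    u = mapAt 1 not u
neighbour (suc (suc i)) u = mapAt (suc i) (_xor bit u 0) (mapAt (suc (suc i)) not u)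

bit-mapAt-not : ∀ {n} k (u : Vertex n) → k < n → bit u k ≡ not (bit (mapAt k not u) k)
bit-mapAt-not k u k<n = trans (sym (not-involutive _)) (cong not (sym (bit-mapAt-≡ k not u k<n)))

neighbour-adjacent : ∀ {n} k (u : Vertex n) → k < n → LTQAdj n u (neighbour k u)
neighbour-adjacent zero u k<n =
  inj₂ (0 , s≤s z≤n , bit-mapAt-not 0 u k<n , λ r _ r≢0 → sym (bit-mapAt-≢ 0 not r u r≢0))
neighbour-adjacent (suc zero) u k<n =
  inj₂ (1 , s≤s (s≤s z≤n) , bit-mapAt-not 1 u k<n , λ r _ r≢1 → sym (bit-mapAt-≢ 1 not r u r≢1))
neighbour-adjacent (suc (suc i)) u k<n =
  inj₁ (suc (suc i) , s≤s (s≤s z≤n) , k<n , flip , twist , unchanged)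
  where
  k = suc (suc i)
  c = bit u 0
  u′ = mapAt k not u
  i+1<n : suc i < _
  i+1<n = <-trans (n<1+n (suc i)) k<n
  flip : bit u k ≡ not (bit (mapAt (suc i) (_xor c) u′) k)
  flip = trans (bit-mapAt-not k u k<n) (cong not (sym (bit-mapAt-≢ (suc i) (_xor c) k u′ λ ())))
  twist : bit u (suc i) ≡ bit (mapAt (suc i) (_xor c) u′) (suc i) xor c
  twist = begin
    bit u (suc i)                                 ≡⟨ xor-identityʳ _ ⟨
    bit u (suc i) xor false                       ≡⟨ cong (bit u (suc i) xor_) (xor-same c) ⟨
    bit u (suc i) xor (c xor c)                   ≡⟨ xor-assoc (bit u (suc i)) c c ⟨
    (bit u (suc i) xor c) xor c                   ≡⟨ cong (λ b → (b xor c) xor c) (bit-mapAt-≢ k not (suc i) u λ ()) ⟨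
    (bit u′ (suc i) xor c) xor c                  ≡⟨ cong (_xor c) (bit-mapAt-≡ (suc i) (_xor c) u′ i+1<n) ⟨
    bit (mapAt (suc i) (_xor c) u′) (suc i) xor c ∎
    where open ≡-Reasoning
  unchanged : ∀ r → r < _ → r ≢ k → r ≢ suc i → bit u r ≡ bit (mapAt (suc i) (_xor c) u′) r
  unchanged r _ r≢k r≢i+1 =
    sym (trans (bit-mapAt-≢ (suc i) (_xor c) r u′ r≢i+1) (bit-mapAt-≢ k not r u r≢k))

bit-neighbour-self : ∀ {n} k (u : Vertex n) → k < n → bit (neighbour k u) k ≡ not (bit u k)
bit-neighbour-self zero          u k<n = bit-mapAt-≡ 0 not u k<n
bit-neighbour-self (suc zero)    u k<n = bit-mapAt-≡ 1 not u k<n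
bit-neighbour-self (suc (suc i)) u k<n =
  trans (bit-mapAt-≢ (suc i) (_xor bit u 0) (suc (suc i)) (mapAt (suc (suc i)) not u) (λ ())) (bit-mapAt-≡ (suc (suc i)) not u k<n)

bit-neighbour-above : ∀ {n} k r (u : Vertex n) → k < r → bit (neighbour k u) r ≡ bit u r
bit-neighbour-above zero          r u k<r = bit-mapAt-≢ 0 not r u (>⇒≢ k<r)
bit-neighbour-above (suc zero)    r u k<r = bit-mapAt-≢ 1 not r u (>⇒≢ k<r)
bit-neighbour-above (suc (suc i)) r u k<r =
  trans (bit-mapAt-≢ (suc i) (_xor bit u 0) r (mapAt (suc (suc i)) not u) (>⇒≢ (<-trans (n<1+n (suc i)) k<r)))
        (bit-mapAt-≢ (suc (suc i)) not r u (>⇒≢ k<r))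

neighbours : ∀ {n} → ℕ → Vertex n → List (Vertex n)
neighbours zero    u = []
neighbours (suc k) u = neighbour (suc k) u ∷ neighbours k u

length-neighbours : ∀ {n} k (u : Vertex n) → length (neighbours k u) ≡ k
length-neighbours zero    u = refl
length-neighbours (suc k) u = cong suc (length-neighbours k u)

neighbour-∉-neighbours : ∀ {n} k j (u : Vertex n) → k < n → j < k →
  All (neighbour k u ≢_) (neighbours j u)
neighbour-∉-neighbours k zero    u _   _   = []
neighbour-∉-neighbours k (suc j) u k<n j<k =
  (λ same → not-¬ refl (begin
    bit u k                        ≡⟨ bit-neighbour-above (suc j) k u j<k ⟨
    bit (neighbour (suc j) u) k    ≡⟨ cong (λ v → bit v k) same ⟨
    bit (neighbour k u) k          ≡⟨ bit-neighbour-self k u k<n ⟩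
    not (bit u k)                  ∎))
  ∷ neighbour-∉-neighbours k j u k<n (<-trans (n<1+n j) j<k)
  where open ≡-Reasoning

neighbours-unique : ∀ {n} k (u : Vertex n) → k < n → Unique (neighbours k u)
neighbours-unique zero    u _   = []
neighbours-unique (suc k) u k<n =
  neighbour-∉-neighbours (suc k) k u k<n (n<1+n k)
  ∷ neighbours-unique k u (<-trans (n<1+n k) k<n)

goodNeighbor-of-invariant : ∀ {n g} (F : VSet n) → g < n →
  (∀ k u → 1 ≤ k → k ≤ g → F (neighbour k u) ≡ F u) → GoodNeighbor n g F
goodNeighbor-of-invariant {n} {g} F g<n invariant u u∉F =
  neighbours g u , neighbours-unique g u g<n , ≤-reflexive (sym (length-neighbours g u)) ,
  fault-free g ≤-refl
  where
  fault-free : ∀ k → k ≤ g → All (λ v → LTQAdj n u v × F v ≡ false) (neighbours k u)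
  fault-free zero    _   = []
  fault-free (suc k) k<g =
    (neighbour-adjacent (suc k) u (≤-<-trans k<g g<n) , trans (invariant (suc k) u (s≤s z≤n) k<g) u∉F)
    ∷ fault-free k (<⇒≤ k<g)

-- outer g u = u₀ ∷ u_{g+1} ∷ … ∷ u_{n-1}; the subcube A is where it is all false.
outer : ∀ {m} → ℕ → Vertex (suc m) → List Bool
outer g (b ∷ w) = b ∷ drop g (toList w)

outer-neighbour : ∀ {m} g k (u : Vertex (suc m)) → 1 ≤ k → k ≤ g →
  outer g (neighbour k u) ≡ outer g u
outer-neighbour g (suc zero) (b ∷ w) _ 1≤g = cong (b ∷_) (drop-toList-mapAt g 0 not w 1≤g)
outer-neighbour g (suc (suc i)) (b ∷ w) _ k≤g =
  cong (b ∷_) (trans (drop-toList-mapAt g i (_xor b) _ (<-trans (n<1+n i) k≤g))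
                     (drop-toList-mapAt g (suc i) not w k≤g))

goodNeighbor-outer : ∀ {m} g (P : List Bool → Bool) → g ≤ m → GoodNeighbor (suc m) g (P ∘ outer g)
goodNeighbor-outer g P g≤m = goodNeighbor-of-invariant (P ∘ outer g) (s≤s g≤m)
  (λ k u 1≤k k≤g → cong P (outer-neighbour g k u 1≤k k≤g))

size-outer : ∀ {m} g (P : List Bool → Bool) → g ≤ m →
  size {suc m} (P ∘ outer g) ≡ 2 ^ g * size {suc (m ∸ g)} (P ∘ toList)
size-outer {m} g P g≤m = begin
  size {suc m} (P ∘ outer g)
    ≡⟨ size-∷ m (P ∘ outer g) ⟩
  size {m} (λ w → P (false ∷ drop g (toList w))) + size {m} (λ w → P (true ∷ drop g (toList w)))
    ≡⟨ cong₂ _+_ (size-drop (P ∘ (false ∷_)) g g≤m) (size-drop (P ∘ (true ∷_)) g g≤m) ⟩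
  2 ^ g * size {m ∸ g} (λ w → P (false ∷ toList w)) + 2 ^ g * size {m ∸ g} (λ w → P (true ∷ toList w))
    ≡⟨ *-distribˡ-+ (2 ^ g) _ _ ⟨
  2 ^ g * (size {m ∸ g} (λ w → P (false ∷ toList w)) + size {m ∸ g} (λ w → P (true ∷ toList w)))
    ≡⟨ cong (2 ^ g *_) (size-∷ (m ∸ g) (P ∘ toList)) ⟨
  2 ^ g * size {suc (m ∸ g)} (P ∘ toList) ∎
  where open ≡-Reasoning

outerWeight≡1 outerWeight≤1 : ∀ {m} → ℕ → VSet (suc m)
outerWeight≡1 g = exactlyOneTrue ∘ outer g
outerWeight≤1 g = atMostOneTrue ∘ outer g

size-outerWeight≡1 : ∀ {m} g → g ≤ m → size (outerWeight≡1 {m} g) ≡ 2 ^ g * (suc m ∸ g)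
size-outerWeight≡1 {m} g g≤m =
  trans (size-outer g exactlyOneTrue g≤m)
        (cong (2 ^ g *_) (trans (size-exactlyOneTrue (suc (m ∸ g))) (sym (+-∸-assoc 1 g≤m))))

size-outerWeight≤1 : ∀ {m} g → g ≤ m → size (outerWeight≤1 {m} g) ≡ 2 ^ g * (suc m ∸ g + 1)
size-outerWeight≤1 {m} g g≤m =
  trans (size-outer g atMostOneTrue g≤m)
        (cong (2 ^ g *_) (trans (size-atMostOneTrue (suc (m ∸ g))) (cong (_+ 1) (sym (+-∸-assoc 1 g≤m)))))

bit-replicate-false : ∀ m r → bit (replicate m false) r ≡ false
bit-replicate-false zero    r       = refl
bit-replicate-false (suc m) zero    = refl
bit-replicate-false (suc m) (suc r) = bit-replicate-false m r

allFalse-outer-replicate : ∀ {m} g → allFalse (outer g (replicate (suc m) false)) ≡ true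
allFalse-outer-replicate {m} g =
  bit≡false⇒allFalse-drop g (replicate m false) (λ r _ _ → bit-replicate-false m r)

outerWeights-distinct : ∀ {m} g → Distinct (outerWeight≡1 {m} g) (outerWeight≤1 g)
outerWeights-distinct {m} g same =
  allFalse⇒exactlyOneTrue≢atMostOneTrue (outer g (replicate (suc m) false))
    (allFalse-outer-replicate {m} g) (same (replicate (suc m) false))

neighbour-of-A⇒outerWeight≤1 : ∀ {m} g (u v : Vertex (suc m)) → LTQAdj (suc m) u v →
  allFalse (outer g v) ≡ true → outerWeight≤1 g u ≡ true
neighbour-of-A⇒outerWeight≤1 g u (true ∷ x) _ ()
neighbour-of-A⇒outerWeight≤1 g (true ∷ y) (false ∷ x) (inj₂ (zero , _ , refl , agree)) v∈A =
  bit≡false⇒allFalse-drop g y (λ r g≤r r<m →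
    trans (agree (suc r) (s≤s r<m) λ ()) (allFalse-drop⇒bit≡false g x v∈A r g≤r))
neighbour-of-A⇒outerWeight≤1 g (d ∷ y) (false ∷ x) (inj₂ (suc zero , _ , _ , agree)) v∈A
  rewrite agree 0 (s≤s z≤n) (λ ()) =
  bit≡false⇒atMostOneTrue-drop g 0 y (λ r g≤r r<m r≢0 →
    trans (agree (suc r) (s≤s r<m) (r≢0 ∘ suc-injective)) (allFalse-drop⇒bit≡false g x v∈A r g≤r))
neighbour-of-A⇒outerWeight≤1 g u v (inj₂ (suc (suc k) , s≤s (s≤s ()) , _))
neighbour-of-A⇒outerWeight≤1 g u v (inj₁ (zero , () , _))
neighbour-of-A⇒outerWeight≤1 g u v (inj₁ (suc zero , s≤s () , _))
neighbour-of-A⇒outerWeight≤1 g (d ∷ y) (false ∷ x) (inj₁ (suc (suc i) , _ , _ , _ , twist , agree)) v∈A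
  with refl ← agree 0 (s≤s z≤n) (λ ()) (λ ()) =
  bit≡false⇒atMostOneTrue-drop g (suc i) y bits
  where
  x≡0 = allFalse-drop⇒bit≡false g x v∈A
  bits : ∀ r → g ≤ r → r < _ → r ≢ suc i → bit y r ≡ false
  bits r g≤r r<m r≢i+1 with r ≟ i
  ... | yes refl = trans twist (trans (xor-identityʳ _) (x≡0 r g≤r))
  ... | no r≢i   = trans (agree (suc r) (s≤s r<m) (r≢i+1 ∘ suc-injective) (r≢i ∘ suc-injective)) (x≡0 r g≤r)

Indiscernible : (n : ℕ) → VSet n → VSet n → Set
Indiscernible n F₁ F₂ = ∀ u v → LTQAdj n u v → F₂ u ≡ false → F₁ v ≡ F₂ v

outerWeights-indiscernible : ∀ {m} g → Indiscernible (suc m) (outerWeight≡1 g) (outerWeight≤1 g)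
outerWeights-indiscernible g u v u~v u∉F₂ with allFalse (outer g v) in v∈A
... | false = refl
... | true  with () ← trans (sym (neighbour-of-A⇒outerWeight≤1 g u v u~v v∈A)) u∉F₂

indiscernible⇒¬distinguishable-PMC : ∀ {n} {F₁ F₂ : VSet n} → Indiscernible n F₁ F₂ →
  ¬ Distinguishable (PMCSyndrome n) (InSigmaPMC n) F₁ F₂
indiscernible⇒¬distinguishable-PMC {F₁ = F₁} F₁≈F₂ distinguishable =
  distinguishable (λ _ v → F₁ v) (λ _ _ _ _ → refl) F₁≈F₂

indiscernible⇒¬distinguishable-MM : ∀ {n} {F₁ F₂ : VSet n} → Indiscernible n F₁ F₂ →
  ¬ Distinguishable (MMSyndrome n) (InSigmaMM n) F₁ F₂
indiscernible⇒¬distinguishable-MM {F₁ = F₁} F₁≈F₂ distinguishable =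
  distinguishable (λ _ u v → F₁ u ∨ F₁ v) (λ _ _ _ _ _ _ _ → refl)
    (λ w u v w~u w~v _ w∉F₂ → cong₂ _∨_ (F₁≈F₂ w u w~u w∉F₂) (F₁≈F₂ w v w~v w∉F₂))

diagnosable-bound : ∀ {n g} X {Syn : Set} {InSigma : VSet n → Syn → Set} {F₁ F₂ : VSet n} →
  GoodNeighbor n g F₁ → GoodNeighbor n g F₂ → size F₁ ≤ X → size F₂ ≤ X → Distinct F₁ F₂ →
  ¬ Distinguishable Syn InSigma F₁ F₂ →
  ∀ t → GoodNeighborDiagnosable n g Syn InSigma t → t ≤ X ∸ 1
diagnosable-bound X good₁ good₂ |F₁|≤X |F₂|≤X F₁≢F₂ indistinguishable t diagnosable with X ≤? t
... | yes X≤t = ⊥-elim (indistinguishable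
      (diagnosable _ _ good₁ good₂ (≤-trans |F₁|≤X X≤t) (≤-trans |F₂|≤X X≤t) F₁≢F₂))
... | no X≰t = subst (t ≤_) (pred[m∸n]≡m∸[1+n] X 0) (<⇒≤pred (≰⇒> X≰t))

lemma10 : ∀ (n g : ℕ) → 4 ≤ n → 1 ≤ g → g ≤ n ∸ 3 →
    (∀ t → GoodNeighborDiagnosable n g (PMCSyndrome n) (InSigmaPMC n) t →
       t ≤ 2 ^ g * (n ∸ g + 1) ∸ 1)
    × (∀ t → GoodNeighborDiagnosable n g (MMSyndrome n) (InSigmaMM n) t →
       t ≤ 2 ^ g * (n ∸ g + 1) ∸ 1)
lemma10 (suc m) g (s≤s _) _ g≤n∸3 =
  bound (indiscernible⇒¬distinguishable-PMC indiscernible) ,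
  bound (indiscernible⇒¬distinguishable-MM indiscernible)
  where
  g≤m : g ≤ m
  g≤m = ≤-trans g≤n∸3 (m∸n≤m m 2)
  X = 2 ^ g * (suc m ∸ g + 1)
  indiscernible = outerWeights-indiscernible g
  bound : ∀ {Syn : Set} {InSigma : VSet (suc m) → Syn → Set} →
    ¬ Distinguishable Syn InSigma (outerWeight≡1 g) (outerWeight≤1 g) →
    ∀ t → GoodNeighborDiagnosable (suc m) g Syn InSigma t → t ≤ X ∸ 1
  bound = diagnosable-bound X
    (goodNeighbor-outer g exactlyOneTrue g≤m) (goodNeighbor-outer g atMostOneTrue g≤m)
    (≤-trans (≤-reflexive (size-outerWeight≡1 g g≤m)) (*-monoʳ-≤ (2 ^ g) (m≤m+n _ 1)))
    (≤-reflexive (size-outerWeight≤1 g g≤m))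
    (outerWeights-distinct g)
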